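{- Let $X$ and $Y$ be disjoint posets and let $i_X:X\to\overline{X}$, $i_Y:Y\to\overline{Y}$ be order embeddings with $\overline{X}\cap\overline{Y}=\emptyset$. For $R\subseteq X\times Y$ define $\overline{R}\subseteq\overline{X}\times\overline{Y}$ by $x'\mathrel{\overline{R}}y'$ iff there are $x\in X$, $y\in Y$ with $x'\le_{\overline{X}}i_X(x)$, $i_Y(y)\le_{\overline{Y}}y'$ and $x\mathrel{R}y$; for $S\subseteq\overline{X}\times\overline{Y}$ define $\underline{S}\subseteq X\times Y$ by $x\mathrel{\underline{S}}y\iff i_X(x)\mathrel{S}i_Y(y)$. Then: (1) for every $R\subseteq X\times Y$ we have $R\subseteq\underline{(\overline{R})}$, and if $(X,Y,R)$ is 0-coherent then $R=\underline{(\overline{R})}$; (2) for every $S\subseteq\overline{X}\times\overline{Y}$ such that $(\overline{X},\overline{Y},S)$ is 0-coherent, $\overline{(\underline{S})}\subseteq S$.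
   Context: A triple $(A,B,T)$ with $A,B$ disjoint posets and $T\subseteq A\times B$ is 0-coherent if (C1) for all $a_1,a_2\in A$, $b\in B$: $a_1\le_A a_2$ and $a_2\mathrel{T}b$ imply $a_1\mathrel{T}b$; and (C2) for all $b_1,b_2\in B$, $a\in A$: $b_1\le_B b_2$ and $a\mathrel{T}b_1$ imply $a\mathrel{T}b_2$. -}

module Defs where

open import Level using (Level; _⊔_)
open import Data.Product using (Σ; _×_; _,_)
open import Relation.Binary.Core using (REL)
open import Relation.Binary.Bundles using (Poset)

record ZeroCoherent {a₁ a₂ a₃ b₁ b₂ b₃ t : Level}
                    (A : Poset a₁ a₂ a₃) (B : Poset b₁ b₂ b₃)
                    (T : REL (Poset.Carrier A) (Poset.Carrier B) t)
                    : Set (a₁ ⊔ a₃ ⊔ b₁ ⊔ b₃ ⊔ t) where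
  field
    C1 : ∀ {x₁ x₂ y} → Poset._≤_ A x₁ x₂ → T x₂ y → T x₁ y
    C2 : ∀ {y₁ y₂ x} → Poset._≤_ B y₁ y₂ → T x y₁ → T x y₂

record IsOrderEmbedding {a₁ a₂ a₃ b₁ b₂ b₃ : Level}
                        (A : Poset a₁ a₂ a₃) (B : Poset b₁ b₂ b₃)
                        (i : Poset.Carrier A → Poset.Carrier B)
                        : Set (a₁ ⊔ a₃ ⊔ b₃) where
  field
    monotone  : ∀ {x y} → Poset._≤_ A x y → Poset._≤_ B (i x) (i y)
    reflecting : ∀ {x y} → Poset._≤_ B (i x) (i y) → Poset._≤_ A x y

module _ {x₁ x₂ x₃ y₁ y₂ y₃ X₁ X₂ X₃ Y₁ Y₂ Y₃ : Level}
         (X : Poset x₁ x₂ x₃) (Y : Poset y₁ y₂ y₃)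
         (X̄ : Poset X₁ X₂ X₃) (Ȳ : Poset Y₁ Y₂ Y₃)
         (iX : Poset.Carrier X → Poset.Carrier X̄)
         (iY : Poset.Carrier Y → Poset.Carrier Ȳ) where

  liftRel : ∀ {r} → REL (Poset.Carrier X) (Poset.Carrier Y) r
          → REL (Poset.Carrier X̄) (Poset.Carrier Ȳ) (x₁ ⊔ y₁ ⊔ X₃ ⊔ Y₃ ⊔ r)
  liftRel R x' y' = Σ (Poset.Carrier X) λ x → Σ (Poset.Carrier Y) λ y →
    Poset._≤_ X̄ x' (iX x) × Poset._≤_ Ȳ (iY y) y' × R x y

  lowerRel : ∀ {s} → REL (Poset.Carrier X̄) (Poset.Carrier Ȳ) s
           → REL (Poset.Carrier X) (Poset.Carrier Y) s
  lowerRel S x y = S (iX x) (iY y)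

module Submission where

open import Defs
open import Level using (Level)
open import Data.Product using (_×_; _,_)
open import Relation.Binary.Core using (REL)
open import Relation.Binary.Bundles using (Poset)
open import Relation.Binary using (_⇒_)

module _ {x₁ x₂ x₃ y₁ y₂ y₃ X₁ X₂ X₃ Y₁ Y₂ Y₃ : Level}
         (X : Poset x₁ x₂ x₃) (Y : Poset y₁ y₂ y₃)
         (X̄ : Poset X₁ X₂ X₃) (Ȳ : Poset Y₁ Y₂ Y₃)
         (iX : Poset.Carrier X → Poset.Carrier X̄)
         (iY : Poset.Carrier Y → Poset.Carrier Ȳ) where

  private
    lift  = liftRel X Y X̄ Ȳ iX iY
    lower = lowerRel X Y X̄ Ȳ iX iY

  ⊆-lowerRel-liftRel : ∀ {r} (R : REL (Poset.Carrier X) (Poset.Carrier Y) r) →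
                       R ⇒ lower (lift R)
  ⊆-lowerRel-liftRel R {x} {y} xRy = x , y , Poset.refl X̄ , Poset.refl Ȳ , xRy

  lowerRel-liftRel-⊆ : ∀ {r} {R : REL (Poset.Carrier X) (Poset.Carrier Y) r} →
                       IsOrderEmbedding X X̄ iX → IsOrderEmbedding Y Ȳ iY →
                       ZeroCoherent X Y R → lower (lift R) ⇒ R
  lowerRel-liftRel-⊆ eX eY coh (x₀ , y₀ , x≤x₀ , y₀≤y , x₀Ry₀) =
    C2 (reflecting eY y₀≤y) (C1 (reflecting eX x≤x₀) x₀Ry₀)
    where open ZeroCoherent coh
          open IsOrderEmbedding

  liftRel-lowerRel-⊆ : ∀ {s} {S : REL (Poset.Carrier X̄) (Poset.Carrier Ȳ) s} →
                       ZeroCoherent X̄ Ȳ S → lift (lower S) ⇒ S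
  liftRel-lowerRel-⊆ coh (x , y , x'≤iXx , iYy≤y' , iXx-S-iYy) =
    C2 iYy≤y' (C1 x'≤iXx iXx-S-iYy)
    where open ZeroCoherent coh

lemma6p10 : ∀ {x₁ x₂ x₃ y₁ y₂ y₃ X₁ X₂ X₃ Y₁ Y₂ Y₃ r s : Level}
    (X : Poset x₁ x₂ x₃) (Y : Poset y₁ y₂ y₃)
    (X̄ : Poset X₁ X₂ X₃) (Ȳ : Poset Y₁ Y₂ Y₃)
    (iX : Poset.Carrier X → Poset.Carrier X̄)
    (iY : Poset.Carrier Y → Poset.Carrier Ȳ)
    → IsOrderEmbedding X X̄ iX → IsOrderEmbedding Y Ȳ iY
    → ((R : REL (Poset.Carrier X) (Poset.Carrier Y) r)
        → (R ⇒ lowerRel X Y X̄ Ȳ iX iY (liftRel X Y X̄ Ȳ iX iY R))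
          × (ZeroCoherent X Y R
             → lowerRel X Y X̄ Ȳ iX iY (liftRel X Y X̄ Ȳ iX iY R) ⇒ R))
      × ((S : REL (Poset.Carrier X̄) (Poset.Carrier Ȳ) s)
        → ZeroCoherent X̄ Ȳ S
        → liftRel X Y X̄ Ȳ iX iY (lowerRel X Y X̄ Ȳ iX iY S) ⇒ S)
lemma6p10 X Y X̄ Ȳ iX iY eX eY =
    (λ R → ⊆-lowerRel-liftRel X Y X̄ Ȳ iX iY R
         , lowerRel-liftRel-⊆ X Y X̄ Ȳ iX iY eX eY)
  , (λ S → liftRel-lowerRel-⊆ X Y X̄ Ȳ iX iY)
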